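{- Let $G$ be a connected cubic graph with a $1$-factor $F$, and let $X=G/F$. Then $G$ is Hamiltonian if and only if $X$ contains a good Eulerian subgraph.
   Context: Let $Y=G-F$ be the complementary $2$-factor. $X=G/F$ is the quartic multigraph obtained by contracting each edge of $F$: each edge $e=uv\in F$ becomes a vertex $x_e$, and the edges of $Y$ become the edges of $X$ (possibly loops or parallel edges). The four edge-ends of $X$ at $x_e$ correspond to the four edge-ends of $Y$ at $u$ and $v$ (two at $u$, two at $v$). A transition at $x_e$ is an unordered pair of distinct edge-ends at $x_e$; it is non-traversing if both edge-ends come from the same end ($u$ or $v$) of $e$, and traversing otherwise (so there are $2$ non-traversing and $4$ traversing transitions at each vertex). Consider spanning subgraphs $W$ of $X$ in which every vertex has degree $2$ or $4$. Such a $W$ is admissible if at every vertex of degree $2$ in $W$ the transition formed by its two edge-ends in $W$ is traversing. A good Eulerian tour of $W$ is a closed walk traversing every edge of $W$ exactly once such that each passage through a vertex of degree $4$ in $W$ uses a non-traversing transition. A good Eulerian subgraph of $X$ is an admissible such $W$ possessing a good Eulerian tour. -}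

module Defs where

open import Data.Nat using (ℕ; zero; suc; _≤_)
open import Data.Nat.DivMod using (_mod_)
open import Data.Fin using (Fin; toℕ)
open import Data.Product using (Σ; ∃; _×_; _,_; proj₁; proj₂)
open import Data.Sum using (_⊎_)
open import Data.Bool using (Bool; true; false; not)
open import Relation.Binary.PropositionalEquality using (_≡_; _≢_)
open import Relation.Binary.Construct.Closure.ReflexiveTransitive using (Star)
open import Function.Bundles using (_⇔_)

Card : {A : Set} → (A → Set) → ℕ → Set
Card {A} P k =
  Σ (Fin k → A) λ f →
    (∀ i j → f i ≡ f j → i ≡ j) × (∀ i → P (f i)) × (∀ a → P a → ∃ λ i → f i ≡ a)

next : ∀ {k} → Fin (suc k) → Fin (suc k)
next {k} j = suc (toℕ j) mod (suc k)

record Graph : Set where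
  field
    n   : ℕ
    m   : ℕ
    end : Fin m → Bool → Fin n

module _ (G : Graph) where
  open Graph G

  -- an edge-end (dart) is an edge together with the choice of one of its ends
  Dart : Set
  Dart = Fin m × Bool

  at : Dart → Fin n
  at (e , b) = end e b

  SameEnds : Fin m → Fin m → Set
  SameEnds e e' = (end e false ≡ end e' false × end e true ≡ end e' true)
                ⊎ (end e false ≡ end e' true × end e true ≡ end e' false)

  Simple : Set
  Simple = (∀ e → end e false ≢ end e true) × (∀ e e' → SameEnds e e' → e ≡ e')

  Cubic : Set
  Cubic = ∀ v → Card (λ (d : Dart) → at d ≡ v) 3

  Adjacent : Fin n → Fin n → Set
  Adjacent u v = ∃ λ e → (end e false ≡ u × end e true ≡ v)
                       ⊎ (end e false ≡ v × end e true ≡ u)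

  Connected : Set
  Connected = (1 ≤ n) × (∀ u v → Star Adjacent u v)

  Hamiltonian : Set
  Hamiltonian =
    Σ ℕ λ k → Σ (Fin (suc k) → Fin n) λ c →
      (3 ≤ suc k) × (∀ i j → c i ≡ c j → i ≡ j) × (∀ v → ∃ λ i → c i ≡ v)
      × (∀ j → Adjacent (c j) (c (next j)))

  OneFactor : (Fin m → Bool) → Set
  OneFactor F = ∀ v → Card (λ (d : Dart) → F (proj₁ d) ≡ true × at d ≡ v) 1

  -- X = G/F.  Vertices of X: edges e with F e ≡ true.  Edges of X: edges of
  -- Y = G - F (F d ≡ false).  The edge-ends of X at x_e are the darts of Y
  -- whose endpoint is an end of e.

  module _ (F : Fin m → Bool) where

    -- G-vertex a is one of the two ends of the F-edge e (i.e. a is contracted into x_e)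
    InX : Fin m → Fin n → Set
    InX e a = F e ≡ true × (end e false ≡ a ⊎ end e true ≡ a)

    -- W is a spanning subgraph of X, given as a set of edges of Y.
    -- Edge-ends of W at x_e:
    WEnd : (Fin m → Bool) → Fin m → Dart → Set
    WEnd W e d = W (proj₁ d) ≡ true × InX e (at d)

    DegW : (Fin m → Bool) → Fin m → ℕ → Set
    DegW W e k = Card (WEnd W e) k

    -- a transition (pair of distinct edge-ends at x_e) is traversing iff the
    -- two edge-ends come from different ends of e, i.e. different G-vertices
    Traversing : Dart → Dart → Set
    Traversing d d' = at d ≢ at d'

    NonTraversing : Dart → Dart → Set
    NonTraversing d d' = at d ≡ at d'

    SubgraphOfX : (Fin m → Bool) → Set
    SubgraphOfX W = ∀ d → W d ≡ true → F d ≡ false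

    Degrees24 : (Fin m → Bool) → Set
    Degrees24 W = ∀ e → F e ≡ true → DegW W e 2 ⊎ DegW W e 4

    Admissible : (Fin m → Bool) → Set
    Admissible W = ∀ e → F e ≡ true → DegW W e 2 →
      ∀ d d' → WEnd W e d → WEnd W e d' → d ≢ d' → Traversing d d'

    -- Good Eulerian tour: a cyclic sequence of oriented edges τ j (traversed
    -- from end (o j) to end (not (o j))), using every edge of W exactly once,
    -- forming a closed walk in X, and passing through degree-4 vertices of W
    -- only by non-traversing transitions.
    GoodEulerianTour : (Fin m → Bool) → Set
    GoodEulerianTour W =
      Σ ℕ λ k → Σ (Fin (suc k) → Fin m) λ τ → Σ (Fin (suc k) → Bool) λ o →
        let inEnd  : Fin (suc k) → Dart
            inEnd j = (τ j , not (o j))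
            outEnd : Fin (suc k) → Dart
            outEnd j = (τ j , o j)
        in (∀ j → W (τ j) ≡ true)
         × (∀ i j → τ i ≡ τ j → i ≡ j)
         × (∀ d → W d ≡ true → ∃ λ j → τ j ≡ d)
         × (∀ j → ∃ λ e → InX e (at (inEnd j)) × InX e (at (outEnd (next j))))
         × (∀ j e → InX e (at (inEnd j)) → DegW W e 4 →
              NonTraversing (inEnd j) (outEnd (next j)))

    GoodEulerianSubgraph : (Fin m → Bool) → Set
    GoodEulerianSubgraph W =
      SubgraphOfX W × Degrees24 W × Admissible W × GoodEulerianTour W

module Submission where

-- (⇒) Given a Hamiltonian cycle c, let W be the set of cycle edges outside F.  Since F is
-- a matching, no two consecutive cycle edges lie in F, so walking along c and skipping
-- the F-edges gives a good Eulerian tour of W: F-edges on the cycle become degree-2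
-- vertices of W, passed by a traversing transition; the other F-edges become degree-4
-- vertices, passed twice by non-traversing transitions.
-- (⇐) Given a good Eulerian tour, list its darts  depart 0, arrive 0, depart 1, …  and
-- drop the arriving darts followed by a non-traversing passage.  The vertices of the
-- remaining darts form a Hamiltonian cycle: a vertex repeats only when two darts share
-- it, which happens exactly at the dropped non-traversing passages.
--
-- The common tool is thinning a closed walk (filter-cycle): deleting entries, no two of
-- them consecutive, from a closed walk leaves a cyclic sequence whose steps are one or
-- two original steps.

open import Defs
open import Data.Nat using (ℕ; zero; suc; _≤_; _<_; z≤n; s≤s)
open import Data.Nat.Properties using (≤-pred; m≤n⇒m<n∨m≡n; ≤-antisym; suc-injective; 1+n≢n; <⇒≤)
open import Data.Nat.DivMod using (_%_; n%n≡0; m<n⇒m%n≡m)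
open import Data.Fin using (Fin; toℕ; fromℕ; fromℕ<; inject₁) renaming (zero to fzero; suc to fsuc)
open import Data.Fin.Properties using (toℕ<n; toℕ-inject₁; toℕ-fromℕ<; toℕ-fromℕ; toℕ-injective; injective⇒≤)
import Data.Fin.Properties as Fin
open import Data.Fin.Patterns using (0F; 1F; 2F)
open import Data.Bool using (Bool; true; false; not)
import Data.Bool.Properties as Bool
open import Data.Product using (Σ; ∃; _×_; _,_; proj₁; proj₂)
open import Data.Product.Properties using (≡-dec)
open import Data.Sum using (_⊎_; inj₁; inj₂; [_,_]′)
open import Data.Unit using (⊤; tt)
open import Data.Empty using (⊥; ⊥-elim)
open import Data.List using (List; []; _∷_; length; lookup; tabulate; filter; _++_; _∷ʳ_; allFin)
open import Data.List.Properties using (filter-++; filter-reject; ++-identityʳ)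
open import Data.List.Relation.Unary.All using (All; []; _∷_; universal)
import Data.List.Relation.Unary.All as All
open import Data.List.Relation.Unary.Any using (here; there; index)
open import Data.List.Relation.Unary.Any.Properties using (lookup-index)
open import Data.List.Relation.Unary.Unique.Propositional using (Unique; []; _∷_)
import Data.List.Relation.Unary.Unique.Propositional.Properties as Unique
open import Data.List.Membership.Propositional using (_∈_)
open import Data.List.Membership.Propositional.Properties using (∈-filter⁺; ∈-filter⁻; ∈-lookup; ∈-allFin)
open import Relation.Nullary using (¬_; Dec; yes; no; does; contradiction)
open import Relation.Nullary.Decidable using (dec-true; _×-dec_; ¬?; decidable-stable)
open import Relation.Unary using (Decidable)
open import Relation.Binary.PropositionalEquality
open import Relation.Binary.Definitions using (DecidableEquality)
open import Function.Bundles using (_⇔_; mk⇔)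

toℕ-next : ∀ {k} (j : Fin (suc k)) → toℕ j < k → toℕ (next j) ≡ suc (toℕ j)
toℕ-next {k} j j<k = trans (toℕ-fromℕ< _) (m<n⇒m%n≡m (s≤s j<k))

next-wraps : ∀ {k} (j : Fin (suc k)) → toℕ j ≡ k → next j ≡ fzero
next-wraps {k} j j≡k = toℕ-injective (trans (toℕ-fromℕ< _)
  (trans (cong (λ i → suc i % suc k) j≡k) (n%n≡0 (suc k))))

next-cases : ∀ {k} (j : Fin (suc k)) →
  (toℕ j < k × toℕ (next j) ≡ suc (toℕ j)) ⊎ (toℕ j ≡ k × next j ≡ fzero)
next-cases j with m≤n⇒m<n∨m≡n (≤-pred (toℕ<n j))
... | inj₁ j<k = inj₁ (j<k , toℕ-next j j<k)
... | inj₂ j≡k = inj₂ (j≡k , next-wraps j j≡k)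

next-inject₁ : ∀ {k} (j : Fin k) → next (inject₁ j) ≡ fsuc j
next-inject₁ {k} j = toℕ-injective (trans (toℕ-next (inject₁ j) inject₁<k) (cong suc (toℕ-inject₁ j)))
  where
    inject₁<k : toℕ (inject₁ j) < k
    inject₁<k = subst (_< k) (sym (toℕ-inject₁ j)) (toℕ<n j)

next-fromℕ : ∀ k → next (fromℕ k) ≡ fzero
next-fromℕ k = next-wraps (fromℕ k) (toℕ-fromℕ k)

predecessor : ∀ {k} (j : Fin (suc k)) → ∃ λ i → next i ≡ j
predecessor fzero = fromℕ _ , next-fromℕ _
predecessor (fsuc i) = inject₁ i , next-inject₁ i

next-injective : ∀ {k} (i j : Fin (suc k)) → next i ≡ next j → i ≡ j
next-injective i j eq with next-cases i | next-cases j
... | inj₁ (_ , si) | inj₁ (_ , sj) =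
  toℕ-injective (suc-injective (trans (sym si) (trans (cong toℕ eq) sj)))
... | inj₁ (_ , si) | inj₂ (_ , zj) = contradiction (trans (sym si) (cong toℕ (trans eq zj))) (λ ())
... | inj₂ (_ , zi) | inj₁ (_ , sj) = contradiction (trans (sym sj) (cong toℕ (trans (sym eq) zi))) (λ ())
... | inj₂ (ik , _) | inj₂ (jk , _) = toℕ-injective (trans ik (sym jk))

next≢ : ∀ {k} → 2 ≤ suc k → (j : Fin (suc k)) → next j ≢ j
next≢ _ j eq with next-cases j
... | inj₁ (_ , sj) = 1+n≢n (trans (sym sj) (cong toℕ eq))
... | inj₂ (jk , zj) with trans (sym zj) eq
next≢ (s≤s (s≤s _)) j eq | inj₂ (() , _) | refl

next²≢ : ∀ {k} → 3 ≤ suc k → (j : Fin (suc k)) → next (next j) ≢ j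
next²≢ {k@(suc (suc _))} (s≤s (s≤s (s≤s _))) j eq with next-cases j
... | inj₂ (jk , zj) = contradiction (trans next-zero≡j jk) (λ ())
  where
    next-zero≡j : 1 ≡ toℕ j
    next-zero≡j = trans (sym (toℕ-next {k} fzero (s≤s z≤n))) (cong toℕ (trans (cong next (sym zj)) eq))
next²≢ {k@(suc (suc _))} (s≤s (s≤s (s≤s _))) j eq | inj₁ (_ , sj) with next-cases (next j)
...   | inj₁ (_ , snj) = n≢2+n (toℕ j) (trans (sym (cong toℕ eq)) (trans snj (cong suc sj)))
  where
    n≢2+n : ∀ n → n ≢ suc (suc n)
    n≢2+n (suc n) e = n≢2+n n (suc-injective e)
...   | inj₂ (nk , znj) with trans (sym znj) eq
...     | refl = contradiction (trans (sym sj) nk) (λ ())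

-- Closed walks as lists.  Path R x ys z says x R y₁ R … R yₙ R z for ys = y₁ … yₙ;
-- a closed walk is a Path R x ys x, read cyclically as the sequence x ∷ ys.

data Path {A : Set} (R : A → A → Set) : A → List A → A → Set where
  finish : ∀ {x z} → R x z → Path R x [] z
  _◅_ : ∀ {x y ys z} → R x y → Path R y ys z → Path R x (y ∷ ys) z

infixr 5 _◅_

data LastOrInner : ∀ {k} → Fin (suc k) → Set where
  last : ∀ {k} → LastOrInner (fromℕ k)
  inner : ∀ {k} (j : Fin k) → LastOrInner (inject₁ j)

last-or-inner : ∀ {k} (i : Fin (suc k)) → LastOrInner i
last-or-inner {zero} fzero = last
last-or-inner {suc k} fzero = inner fzero
last-or-inner {suc k} (fsuc i) with last-or-inner i
... | last = last
... | inner j = inner (fsuc j)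

module _ {A : Set} {R : A → A → Set} where

  path-inner : ∀ {x ys z} → Path R x ys z → (j : Fin (length ys)) →
               R (lookup (x ∷ ys) (inject₁ j)) (lookup ys j)
  path-inner (r ◅ p) fzero = r
  path-inner (r ◅ p) (fsuc j) = path-inner p j

  path-last : ∀ {x ys z} → Path R x ys z → R (lookup (x ∷ ys) (fromℕ (length ys))) z
  path-last (finish r) = r
  path-last (r ◅ p) = path-last p

  closed-step : ∀ {x ys} → Path R x ys x → ∀ i → R (lookup (x ∷ ys) i) (lookup (x ∷ ys) (next i))
  closed-step {x} {ys} p i with last-or-inner i
  ... | last rewrite next-fromℕ (length ys) = path-last p
  ... | inner j rewrite next-inject₁ j = path-inner p j

  tabulate-path : ∀ {k} (g : Fin (suc k) → A) {z} → (∀ (j : Fin k) → R (g (inject₁ j)) (g (fsuc j))) →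
                  R (g (fromℕ k)) z → Path R (g fzero) (tabulate (λ j → g (fsuc j))) z
  tabulate-path {zero} g steps r = finish r
  tabulate-path {suc k} g steps r = steps fzero ◅ tabulate-path (λ j → g (fsuc j)) (λ j → steps (fsuc j)) r

  cyclic-path : ∀ {k} (f : Fin (suc k) → A) → (∀ j → R (f j) (f (next j))) →
                Path R (f fzero) (tabulate (λ j → f (fsuc j))) (f fzero)
  cyclic-path {k} f steps = tabulate-path f inner-step last-step
    where
      inner-step : ∀ (j : Fin k) → R (f (inject₁ j)) (f (fsuc j))
      inner-step j = subst (λ i → R (f (inject₁ j)) (f i)) (next-inject₁ j) (steps (inject₁ j))
      last-step : R (f (fromℕ k)) (f fzero)
      last-step = subst (λ i → R (f (fromℕ k)) (f i)) (next-fromℕ k) (steps (fromℕ k))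

  path-snoc : ∀ {x ys z w} → Path R x ys z → R z w → Path R x (ys ∷ʳ z) w
  path-snoc (finish r) r' = r ◅ finish r'
  path-snoc (r ◅ p) r' = r ◅ path-snoc p r'

lookup-injective : ∀ {A : Set} {xs : List A} → Unique xs → ∀ i j → lookup xs i ≡ lookup xs j → i ≡ j
lookup-injective (_ ∷ _) fzero fzero _ = refl
lookup-injective (x∉ ∷ _) fzero (fsuc j) eq = contradiction eq (All.lookup x∉ (∈-lookup j))
lookup-injective (x∉ ∷ _) (fsuc i) fzero eq = contradiction (sym eq) (All.lookup x∉ (∈-lookup i))
lookup-injective (_ ∷ u) (fsuc i) (fsuc j) eq = cong fsuc (lookup-injective u i j eq)

-- Deleting entries from a closed walk.  A step of the thinned walk is either an original
-- step or two original steps across a deleted entry.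

Skip : {A : Set} → (A → A → Set) → (A → Set) → A → A → Set
Skip {A} R P x z = R x z ⊎ ∃ λ w → R x w × ¬ P w × R w z

record FilteredCycle {A : Set} (R : A → A → Set) (P : A → Set) (xs : List A) : Set where
  field
    len : ℕ
    seq : Fin (suc len) → A
    kept : ∀ i → P (seq i)
    injective : ∀ i j → seq i ≡ seq j → i ≡ j
    complete : ∀ a → a ∈ xs → P a → ∃ λ i → seq i ≡ a
    step : ∀ i → Skip R P (seq i) (seq (next i))

module _ {A : Set} {R : A → A → Set} {P : A → Set} (P? : Decidable P)
         (no-two-deleted : ∀ {a b} → R a b → ¬ P a → P b) where

  private
    filter-path : ∀ {x} ys {z} → P z → Path R x ys z → Path (Skip R P) x (filter P? ys) z
    filter-path [] pz (finish r) = finish (inj₁ r)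
    filter-path (y ∷ ys) pz (r ◅ p) with P? y
    ... | yes py = inj₁ r ◅ filter-path ys pz p
    filter-path (y ∷ []) pz (r ◅ finish r') | no ¬py = finish (inj₂ (y , r , ¬py , r'))
    filter-path (y ∷ y' ∷ ys) pz (r ◅ r' ◅ p) | no ¬py with P? y'
    ... | yes py' = inj₂ (y , r , ¬py , r') ◅ filter-path ys pz p
    ... | no ¬py' = contradiction (no-two-deleted r' ¬py) ¬py'

    -- a closed walk starting at a deleted entry is rotated by one step before thinning
    filter-closed : ∀ x ys → Path R x ys x →
      Σ A λ h → Σ (List A) λ hs → filter P? (x ∷ ys) ≡ h ∷ hs × Path (Skip R P) h hs h
    filter-closed x ys p with P? x
    ... | yes px = x , filter P? ys , refl , filter-path ys px p
    filter-closed x [] (finish r) | no ¬px = contradiction (no-two-deleted r ¬px) ¬px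
    filter-closed x (y ∷ ys) (r ◅ p) | no ¬px with P? y
    ... | no ¬py = contradiction (no-two-deleted r ¬px) ¬py
    ... | yes py = y , filter P? ys , refl ,
      subst (λ l → Path (Skip R P) y l y) drop-x (filter-path (ys ∷ʳ x) py (path-snoc p r))
      where
        drop-x : filter P? (ys ∷ʳ x) ≡ filter P? ys
        drop-x = begin
          filter P? (ys ++ x ∷ [])           ≡⟨ filter-++ P? ys (x ∷ []) ⟩
          filter P? ys ++ filter P? (x ∷ []) ≡⟨ cong (filter P? ys ++_) (filter-reject P? ¬px) ⟩
          filter P? ys ++ []                 ≡⟨ ++-identityʳ _ ⟩
          filter P? ys                       ∎
          where open ≡-Reasoning

  filter-cycle : ∀ {x ys} → Unique (x ∷ ys) → Path R x ys x → FilteredCycle R P (x ∷ ys)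
  filter-cycle {x} {ys} u p with filter-closed x ys p
  ... | h , hs , eq , q = record
    { len = length hs
    ; seq = lookup (h ∷ hs)
    ; kept = λ i → proj₂ (∈-filter⁻ P? (subst (lookup (h ∷ hs) i ∈_) (sym eq) (∈-lookup i)))
    ; injective = lookup-injective (subst Unique eq (Unique.filter⁺ P? u))
    ; complete = λ a a∈ pa → let m = subst (a ∈_) eq (∈-filter⁺ P? a∈ pa) in index m , sym (lookup-index m)
    ; step = closed-step q
    }

module _ {A : Set} {P : A → Set} where

  card-≤ : ∀ {k} → Card P k → ∀ {xs} → Unique xs → All P xs → length xs ≤ k
  card-≤ (f , _ , _ , onto) {xs} u ps = injective⇒≤ {f = position} position-injective
    where
      position : Fin (length xs) → _
      position i = proj₁ (onto (lookup xs i) (All.lookup ps (∈-lookup i)))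
      position-injective : ∀ {i j} → position i ≡ position j → i ≡ j
      position-injective {i} {j} eq = lookup-injective u i j (begin
        lookup xs i        ≡⟨ sym (proj₂ (onto (lookup xs i) (All.lookup ps (∈-lookup i)))) ⟩
        f (position i)     ≡⟨ cong f eq ⟩
        f (position j)     ≡⟨ proj₂ (onto (lookup xs j) (All.lookup ps (∈-lookup j))) ⟩
        lookup xs j        ∎)
        where open ≡-Reasoning

  card-list : ∀ {xs} → Unique xs → All P xs → (∀ a → P a → a ∈ xs) → Card P (length xs)
  card-list {xs} u ps covers =
    lookup xs , lookup-injective u , (λ i → All.lookup ps (∈-lookup i)) ,
    λ a pa → let m = covers a pa in index m , sym (lookup-index m)

  card-unique : ∀ {k l} → Card P k → Card P l → k ≡ l
  card-unique c d = ≤-antisym (embed c d) (embed d c)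
    where
      embed : ∀ {k l} → Card P k → Card P l → k ≤ l
      embed (f , f-inj , fP , _) (g , _ , _ , g-onto) = injective⇒≤ {f = λ i → proj₁ (g-onto (f i) (fP i))}
        λ {i} {j} eq → f-inj i j (trans (sym (proj₂ (g-onto (f i) (fP i))))
                                   (trans (cong g eq) (proj₂ (g-onto (f j) (fP j)))))

  card-2-exhausts : DecidableEquality A → Card P 2 → ∀ {a b c} → P a → P b → a ≢ b → P c → c ≡ a ⊎ c ≡ b
  card-2-exhausts _≟_ two {a} {b} {c} pa pb a≢b pc with c ≟ a | c ≟ b
  ... | yes c≡a | _ = inj₁ c≡a
  ... | no _ | yes c≡b = inj₂ c≡b
  ... | no c≢a | no c≢b
    with card-≤ two ((a≢b ∷ ≢-sym c≢a ∷ []) ∷ (≢-sym c≢b ∷ []) ∷ [] ∷ []) (pa ∷ pb ∷ pc ∷ [])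
  ... | s≤s (s≤s ())

same-or-opposite : ∀ x y → x ≡ y ⊎ x ≡ not y
same-or-opposite false false = inj₁ refl
same-or-opposite false true = inj₂ refl
same-or-opposite true false = inj₂ refl
same-or-opposite true true = inj₁ refl

module CubicWithFactor (G : Graph) (simple : Simple G) (cubic : Cubic G)
                       (F : Fin (Graph.m G) → Bool) (one-factor : OneFactor G F) where
  open Graph G

  _≟-dart_ : DecidableEquality (Dart G)
  _≟-dart_ = ≡-dec Fin._≟_ Bool._≟_

  factor-dart : ∀ v → Σ (Dart G) λ d → F (proj₁ d) ≡ true × at G d ≡ v
  factor-dart v with one-factor v
  ... | f , _ , fP , _ = f fzero , fP fzero

  factor-dart-unique : ∀ {v d d'} → F (proj₁ d) ≡ true → at G d ≡ v →
                       F (proj₁ d') ≡ true → at G d' ≡ v → d ≡ d'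
  factor-dart-unique {v} {d} {d'} Fd dv Fd' d'v with d ≟-dart d'
  ... | yes d≡d' = d≡d'
  ... | no d≢d' with card-≤ (one-factor v) ((d≢d' ∷ []) ∷ [] ∷ []) ((Fd , dv) ∷ (Fd' , d'v) ∷ [])
  ... | s≤s ()

  -- three distinct Y-darts cannot share a vertex: together with its F-dart it would have degree 4
  no-three-Y-darts : ∀ {v d₁ d₂ d₃} → F (proj₁ d₁) ≡ false → F (proj₁ d₂) ≡ false → F (proj₁ d₃) ≡ false →
    at G d₁ ≡ v → at G d₂ ≡ v → at G d₃ ≡ v → d₁ ≢ d₂ → d₁ ≢ d₃ → d₂ ≢ d₃ → ⊥
  no-three-Y-darts {v} {d₁} {d₂} {d₃} Y₁ Y₂ Y₃ v₁ v₂ v₃ d₁₂ d₁₃ d₂₃ with factor-dart v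
  ... | d , Fd , dv
    with card-≤ (cubic v) ((not-F Y₁ ∷ not-F Y₂ ∷ not-F Y₃ ∷ []) ∷ (d₁₂ ∷ d₁₃ ∷ []) ∷ (d₂₃ ∷ []) ∷ [] ∷ [])
                          (dv ∷ v₁ ∷ v₂ ∷ v₃ ∷ [])
    where
      not-F : ∀ {d'} → F (proj₁ d') ≡ false → d ≢ d'
      not-F Yd' d≡d' with trans (sym Fd) (trans (cong (λ x → F (proj₁ x)) d≡d') Yd')
      ... | ()
  ... | s≤s (s≤s (s≤s ()))

  no-loop : ∀ e b → end e (not b) ≢ end e b
  no-loop e false eq = proj₁ simple e (sym eq)
  no-loop e true eq = proj₁ simple e eq

  same-ends : ∀ {e e' b b'} → end e b ≡ end e' b' → end e (not b) ≡ end e' (not b') → e ≡ e'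
  same-ends {e} {e'} {false} {false} p q = proj₂ simple e e' (inj₁ (p , q))
  same-ends {e} {e'} {false} {true} p q = proj₂ simple e e' (inj₂ (p , q))
  same-ends {e} {e'} {true} {false} p q = proj₂ simple e e' (inj₂ (q , p))
  same-ends {e} {e'} {true} {true} p q = proj₂ simple e e' (inj₁ (q , p))

  edge-adjacent : ∀ e b → Adjacent G (end e b) (end e (not b))
  edge-adjacent e false = e , inj₁ (refl , refl)
  edge-adjacent e true = e , inj₂ (refl , refl)

  end-in-X : ∀ e b → F e ≡ true → InX G F e (end e b)
  end-in-X e false Fe = Fe , inj₁ refl
  end-in-X e true Fe = Fe , inj₂ refl

  contracted-adjacent : ∀ {e a b} → InX G F e a → InX G F e b → a ≢ b → Adjacent G a b
  contracted-adjacent (_ , inj₁ refl) (_ , inj₁ refl) a≢b = contradiction refl a≢b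
  contracted-adjacent {e} (_ , inj₁ refl) (_ , inj₂ refl) _ = e , inj₁ (refl , refl)
  contracted-adjacent {e} (_ , inj₂ refl) (_ , inj₁ refl) _ = e , inj₂ (refl , refl)
  contracted-adjacent (_ , inj₂ refl) (_ , inj₂ refl) a≢b = contradiction refl a≢b

  other-end : ∀ {e a} b → (end e false ≡ a ⊎ end e true ≡ a) → a ≢ end e b → a ≡ end e (not b)
  other-end false (inj₁ p) a≢ = contradiction (sym p) a≢
  other-end false (inj₂ p) _ = sym p
  other-end true (inj₁ p) _ = sym p
  other-end true (inj₂ p) a≢ = contradiction (sym p) a≢

  -- a nonempty cubic simple graph has three distinct vertices: v and two of its neighbours
  three-vertices : 1 ≤ n → Σ (List (Fin n)) λ vs → Unique vs × length vs ≡ 3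
  three-vertices 1≤n with cubic (fromℕ< 1≤n)
  ... | f , f-inj , fP , _ =
    (v ∷ far (f fzero) ∷ far (f (fsuc fzero)) ∷ []) ,
    ((λ eq → no-loop _ _ (trans (sym eq) (sym (fP fzero)))) ∷
     (λ eq → no-loop _ _ (trans (sym eq) (sym (fP (fsuc fzero))))) ∷ []) ∷
    (far-distinct ∷ []) ∷ [] ∷ [] ,
    refl
    where
      v = fromℕ< 1≤n
      far : Dart G → Fin n
      far (e , b) = end e (not b)
      far-distinct : far (f fzero) ≢ far (f (fsuc fzero))
      far-distinct eq with f fzero in f₀ | f (fsuc fzero) in f₁ | fP fzero | fP (fsuc fzero)
      ... | (e₀ , b₀) | (e₁ , b₁) | at₀ | at₁ with same-ends {e₀} {e₁} {b₀} {b₁} (trans at₀ (sym at₁)) eq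
      ... | refl with same-or-opposite b₀ b₁
      ...   | inj₁ refl = contradiction (f-inj fzero (fsuc fzero) (trans f₀ (sym f₁))) λ ()
      ...   | inj₂ refl = no-loop e₀ b₁ (trans at₀ (sym at₁))

does-sound : ∀ {P : Set} (p? : Dec P) → does p? ≡ true → P
does-sound (yes p) _ = p

module FromHamiltonianCycle (G : Graph) (simple : Simple G) (cubic : Cubic G)
         (F : Fin (Graph.m G) → Bool) (one-factor : OneFactor G F)
         {k : ℕ} (c : Fin (suc k) → Fin (Graph.n G)) (long : 3 ≤ suc k)
         (c-injective : ∀ i j → c i ≡ c j → i ≡ j) (c-onto : ∀ v → ∃ λ i → c i ≡ v)
         (c-adjacent : ∀ j → Adjacent G (c j) (c (next j))) where
  open Graph G
  open CubicWithFactor G simple cubic F one-factor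

  orient : ∀ {u v} → Adjacent G u v → Σ (Fin m) λ e → Σ Bool λ b → end e b ≡ u × end e (not b) ≡ v
  orient (e , inj₁ (p , q)) = e , false , p , q
  orient (e , inj₂ (p , q)) = e , true , q , p

  -- the j-th cycle edge a j runs from c j (its end b j) to c (next j)
  a : Fin (suc k) → Fin m
  a j = proj₁ (orient (c-adjacent j))

  b : Fin (suc k) → Bool
  b j = proj₁ (proj₂ (orient (c-adjacent j)))

  depart arrive : Fin (suc k) → Dart G
  depart j = a j , b j
  arrive j = a j , not (b j)

  at-depart : ∀ j → at G (depart j) ≡ c j
  at-depart j = proj₁ (proj₂ (proj₂ (orient (c-adjacent j))))

  at-arrive : ∀ j → at G (arrive j) ≡ c (next j)
  at-arrive j = proj₂ (proj₂ (proj₂ (orient (c-adjacent j))))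

  next≢self : ∀ j → next j ≢ j
  next≢self = next≢ (<⇒≤ long)

  -- distinct positions carry distinct edges (here the cycle length ≥ 3 is needed)
  a-injective : ∀ i j → a i ≡ a j → i ≡ j
  a-injective i j eq with same-or-opposite (b i) (b j)
  ... | inj₁ b≡ = c-injective i j (trans (sym (at-depart i)) (trans (cong₂ end eq b≡) (at-depart j)))
  ... | inj₂ b≡ = contradiction (trans (cong next j≡ni) (sym i≡nj)) (next²≢ long i)
    where
      i≡nj : i ≡ next j
      i≡nj = c-injective i (next j) (trans (sym (at-depart i)) (trans (cong₂ end eq b≡) (at-arrive j)))
      j≡ni : next i ≡ j
      j≡ni = c-injective (next i) j (trans (sym (at-arrive i))
               (trans (cong₂ end eq (trans (cong not b≡) (Bool.not-involutive (b j)))) (at-depart j)))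

  -- F is a matching, so two consecutive cycle edges are never both in F
  no-two-in-F : ∀ j → F (a j) ≡ true → F (a (next j)) ≡ false
  no-two-in-F j Fj with F (a (next j)) in eq
  ... | false = refl
  ... | true = contradiction (sym (a-injective j (next j) (cong proj₁
                 (factor-dart-unique {d = arrive j} {d' = depart (next j)} Fj (at-arrive j) eq (at-depart (next j))))))
               (next≢self j)

  cycle-edge-ends : ∀ i β → end (a i) β ≡ c i ⊎ end (a i) β ≡ c (next i)
  cycle-edge-ends i β with same-or-opposite β (b i)
  ... | inj₁ refl = inj₁ (at-depart i)
  ... | inj₂ refl = inj₂ (at-arrive i)

  InW : Fin m → Set
  InW d = F d ≡ false × ∃ λ j → a j ≡ d

  InW? : ∀ d → Dec (InW d)
  InW? d = (F d Bool.≟ false) ×-dec Fin.any? (λ j → a j Fin.≟ d)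

  W : Fin m → Bool
  W d = does (InW? d)

  W-elim : ∀ {d} → W d ≡ true → InW d
  W-elim {d} = does-sound (InW? d)

  W-intro : ∀ j → F (a j) ≡ false → W (a j) ≡ true
  W-intro j Yj = dec-true (InW? (a j)) (Yj , j , refl)

  W-darts-at : ∀ d l → W (proj₁ d) ≡ true → at G d ≡ c (next l) → d ≡ arrive l ⊎ d ≡ depart (next l)
  W-darts-at (x , β) l w at-d with W-elim w
  ... | _ , j , refl with same-or-opposite β (b j)
  ...   | inj₁ refl with c-injective j (next l) (trans (sym (at-depart j)) at-d)
  ...     | refl = inj₂ refl
  W-darts-at (x , β) l w at-d | _ , j , refl | inj₂ refl
    with next-injective j l (c-injective (next j) (next l) (trans (sym (at-arrive j)) at-d))
  ...     | refl = inj₁ refl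

  which-end : ∀ {e x} → (end e false ≡ x ⊎ end e true ≡ x) → Σ Bool λ β → end e β ≡ x
  which-end (inj₁ p) = false , p
  which-end (inj₂ p) = true , p

  entered-at : ∀ v → ∃ λ l → c (next l) ≡ v
  entered-at v with c-onto v
  ... | i , ci≡v with predecessor i
  ...   | l , refl = l , ci≡v

  factor-edge-cases : ∀ e → (∃ λ p → a (next p) ≡ e) ⊎ (∀ i → a i ≢ e)
  factor-edge-cases e with Fin.any? (λ i → a i Fin.≟ e)
  ... | yes (i , ai≡e) = inj₁ (proj₁ (predecessor i) , trans (cong a (proj₂ (predecessor i))) ai≡e)
  ... | no off = inj₂ λ i ai≡e → off (i , ai≡e)

  module OnCycle (p : Fin (suc k)) (F-on : F (a (next p)) ≡ true) where
    private
      i = next p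
      e = a i

    before after : Dart G
    before = arrive p
    after = depart (next i)

    Y-before : F (a p) ≡ false
    Y-before with F (a p) in eq
    ... | false = refl
    ... | true = contradiction (trans (sym F-on) (no-two-in-F p eq)) λ ()

    before-end : WEnd G F W e before
    before-end = W-intro p Y-before , subst (InX G F e) (trans (at-depart i) (sym (at-arrive p))) (end-in-X e (b i) F-on)

    after-end : WEnd G F W e after
    after-end = W-intro (next i) (no-two-in-F i F-on) ,
                subst (InX G F e) (trans (at-arrive i) (sym (at-depart (next i)))) (end-in-X e (not (b i)) F-on)

    traversing : at G before ≢ at G after
    traversing eq = next≢self i (sym (c-injective i (next i) (trans (sym (at-arrive p)) (trans eq (at-depart (next i))))))

    only-ends : ∀ d → WEnd G F W e d → d ≡ before ⊎ d ≡ after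
    only-ends d (w , _ , e-ends) with which-end e-ends
    ... | β , eβ with cycle-edge-ends i β
    ...   | inj₁ at-ci with W-darts-at d p w (trans (sym eβ) at-ci)
    ...     | inj₁ d≡before = inj₁ d≡before
    ...     | inj₂ refl = contradiction (trans (sym F-on) (proj₁ (W-elim w))) λ ()
    only-ends d (w , _ , e-ends) | β , eβ | inj₂ at-cni with W-darts-at d i w (trans (sym eβ) at-cni)
    ...     | inj₁ refl = contradiction (trans (sym F-on) (proj₁ (W-elim w))) λ ()
    ...     | inj₂ d≡after = inj₂ d≡after

    degree-2 : DegW G F W e 2
    degree-2 = card-list ((((λ eq → traversing (cong (at G) eq)) ∷ []) ∷ [] ∷ []))
                 (before-end ∷ after-end ∷ [])
                 λ d end-d → [ (λ eq → here eq) , (λ eq → there (here eq)) ]′ (only-ends d end-d)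

  -- An F-edge e = uv off the cycle: in W its vertex has degree 4, the cycle passing
  -- through u and through v.
  module OffCycle (e : Fin m) (Fe : F e ≡ true) (off : ∀ i → a i ≢ e) where
    private
      u = end e false
      v = end e true
      l₁ = proj₁ (entered-at u)
      l₂ = proj₁ (entered-at v)

    -- a cycle dart at an end of e is not in F, since e is the F-edge there
    cycle-dart-end : ∀ j β' β → at G (a j , β') ≡ end e β → WEnd G F W e (a j , β')
    cycle-dart-end j β' β at-end = W-intro j Yj , subst (InX G F e) (sym at-end) (end-in-X e β Fe)
      where
        Yj : F (a j) ≡ false
        Yj with F (a j) in eq
        ... | false = refl
        ... | true = contradiction (cong proj₁ (factor-dart-unique {d = a j , β'} {d' = e , β} eq at-end Fe refl)) (off j)

    at₁ : at G (arrive l₁) ≡ u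
    at₁ = trans (at-arrive l₁) (proj₂ (entered-at u))
    at₂ : at G (depart (next l₁)) ≡ u
    at₂ = trans (at-depart (next l₁)) (proj₂ (entered-at u))
    at₃ : at G (arrive l₂) ≡ v
    at₃ = trans (at-arrive l₂) (proj₂ (entered-at v))
    at₄ : at G (depart (next l₂)) ≡ v
    at₄ = trans (at-depart (next l₂)) (proj₂ (entered-at v))

    passing-darts-differ : ∀ l → arrive l ≢ depart (next l)
    passing-darts-differ l eq = next≢self l (sym (a-injective l (next l) (cong proj₁ eq)))

    ends-differ : ∀ {d d'} → at G d ≡ u → at G d' ≡ v → d ≢ d'
    ends-differ du d'v eq = proj₁ simple e (trans (sym du) (trans (cong (at G) eq) d'v))

    degree-4 : DegW G F W e 4
    degree-4 = card-list
      ((passing-darts-differ l₁ ∷ ends-differ at₁ at₃ ∷ ends-differ at₁ at₄ ∷ []) ∷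
       (ends-differ at₂ at₃ ∷ ends-differ at₂ at₄ ∷ []) ∷ (passing-darts-differ l₂ ∷ []) ∷ [] ∷ [])
      (cycle-dart-end _ _ false at₁ ∷ cycle-dart-end _ _ false at₂ ∷
       cycle-dart-end _ _ true at₃ ∷ cycle-dart-end _ _ true at₄ ∷ [])
      only-ends
      where
        only-ends : ∀ d → WEnd G F W e d → d ∈ (arrive l₁ ∷ depart (next l₁) ∷ arrive l₂ ∷ depart (next l₂) ∷ [])
        only-ends d (w , _ , inj₁ p) with W-darts-at d l₁ w (trans (sym p) (sym (proj₂ (entered-at u))))
        ... | inj₁ eq = here eq
        ... | inj₂ eq = there (here eq)
        only-ends d (w , _ , inj₂ p) with W-darts-at d l₂ w (trans (sym p) (sym (proj₂ (entered-at v))))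
        ... | inj₁ eq = there (there (here eq))
        ... | inj₂ eq = there (there (there (here eq)))

  W-subgraph : SubgraphOfX G F W
  W-subgraph d w = proj₁ (W-elim w)

  W-degrees : Degrees24 G F W
  W-degrees e Fe with factor-edge-cases e
  ... | inj₁ (p , refl) = inj₁ (OnCycle.degree-2 p Fe)
  ... | inj₂ off = inj₂ (OffCycle.degree-4 e Fe off)

  W-admissible : Admissible G F W
  W-admissible e Fe two d d' end-d end-d' d≢d' with factor-edge-cases e
  ... | inj₂ off = contradiction (card-unique (OffCycle.degree-4 e Fe off) two) λ ()
  ... | inj₁ (p , refl) with OnCycle.only-ends p Fe d end-d | OnCycle.only-ends p Fe d' end-d'
  ...   | inj₁ refl | inj₁ refl = contradiction refl d≢d'
  ...   | inj₁ refl | inj₂ refl = OnCycle.traversing p Fe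
  ...   | inj₂ refl | inj₁ refl = ≢-sym (OnCycle.traversing p Fe)
  ...   | inj₂ refl | inj₂ refl = contradiction refl d≢d'

  -- The tour visits the cycle positions whose edge is not in F, in cyclic order.
  Kept : Fin (suc k) → Set
  Kept j = F (a j) ≡ false

  tour-positions : FilteredCycle (λ i j → next i ≡ j) Kept (allFin (suc k))
  tour-positions = filter-cycle (λ j → F (a j) Bool.≟ false) no-two-deleted
                     (Unique.allFin⁺ (suc k)) (cyclic-path (λ j → j) (λ _ → refl))
    where
      no-two-deleted : ∀ {i j} → next i ≡ j → ¬ Kept i → Kept j
      no-two-deleted refl ¬Ki = no-two-in-F _ (Bool.¬-not ¬Ki)

  open FilteredCycle tour-positions using (len; seq; kept; injective; complete; step)

  -- Tour edges at consecutive positions s, s' meet at the contracted vertex of the F-edge at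
  -- c (next s) if they are consecutive on the cycle, and at the skipped F-edge otherwise.
  junction : ∀ {s s'} → Skip (λ i j → next i ≡ j) Kept s s' →
             ∃ λ e → InX G F e (at G (arrive s)) × InX G F e (at G (depart s'))
  junction {s} (inj₁ refl) with factor-dart (c (next s))
  ... | (e , β) , Fe , at-e = e , subst (InX G F e) (trans at-e (sym (at-arrive s))) (end-in-X e β Fe)
                                , subst (InX G F e) (trans at-e (sym (at-depart (next s)))) (end-in-X e β Fe)
  junction {s} (inj₂ (w , refl , ¬Kw , refl)) =
    a w , subst (InX G F (a w)) (trans (at-depart w) (sym (at-arrive s))) (end-in-X (a w) (b w) Fw)
        , subst (InX G F (a w)) (trans (at-arrive w) (sym (at-depart (next w)))) (end-in-X (a w) (not (b w)) Fw)
    where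
      Fw : F (a w) ≡ true
      Fw = Bool.¬-not ¬Kw

  -- a traversing passage only happens across a skipped F-edge, whose degree in W is 2
  non-traversing : ∀ {s s'} → Skip (λ i j → next i ≡ j) Kept s s' → ∀ e → InX G F e (at G (arrive s)) →
                   DegW G F W e 4 → at G (arrive s) ≡ at G (depart s')
  non-traversing {s} (inj₁ refl) _ _ _ = trans (at-arrive s) (sym (at-depart (next s)))
  non-traversing {s} (inj₂ (w , refl , ¬Kw , refl)) e (Fe , e-ends) four
    with which-end e-ends
  ... | β , eβ with factor-dart-unique {d = e , β} {d' = depart w} Fe (trans eβ (at-arrive s))
                      (Bool.¬-not ¬Kw) (at-depart w)
  ...   | refl = contradiction (card-unique four (OnCycle.degree-2 s (Bool.¬-not ¬Kw))) λ ()

  good-tour : GoodEulerianTour G F W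
  good-tour = len , (λ j → a (seq j)) , (λ j → b (seq j)) ,
              (λ j → W-intro (seq j) (kept j)) ,
              (λ i j eq → injective i j (a-injective _ _ eq)) ,
              covers , (λ j → junction (step j)) , (λ j → non-traversing (step j))
    where
      covers : ∀ d → W d ≡ true → ∃ λ j → a (seq j) ≡ d
      covers d w with W-elim w
      ... | Yd , j , refl with complete j (∈-allFin j) Yd
      ...   | i , refl = i , refl

  good-Eulerian-subgraph : GoodEulerianSubgraph G F W
  good-Eulerian-subgraph = W-subgraph , W-degrees , W-admissible , good-tour

-- Write the tour as the cyclic
-- sequence of darts  depart 0, arrive 0, depart 1, arrive 1, …  (each tour edge is left by
-- one dart and entered by the other).  Keep every departing dart, and an arriving dart
-- only when the following passage is traversing; the vertices of the kept darts, in
-- order, form a Hamiltonian cycle.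
module FromGoodEulerianSubgraph (G : Graph) (simple : Simple G) (cubic : Cubic G)
         (F : Fin (Graph.m G) → Bool) (one-factor : OneFactor G F) (nonempty : 1 ≤ Graph.n G)
         (W : Fin (Graph.m G) → Bool) (W-subgraph : SubgraphOfX G F W)
         (W-degrees : Degrees24 G F W) (W-admissible : Admissible G F W)
         {k : ℕ} (τ : Fin (suc k) → Fin (Graph.m G)) (o : Fin (suc k) → Bool)
         (τ-in-W : ∀ j → W (τ j) ≡ true) (τ-injective : ∀ i j → τ i ≡ τ j → i ≡ j)
         (τ-covers : ∀ d → W d ≡ true → ∃ λ j → τ j ≡ d)
         (junction : ∀ j → ∃ λ e → InX G F e (at G (τ j , not (o j))) × InX G F e (at G (τ (next j) , o (next j))))
         (non-traversing : ∀ j e → InX G F e (at G (τ j , not (o j))) → DegW G F W e 4 →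
                           at G (τ j , not (o j)) ≡ at G (τ (next j) , o (next j))) where
  open Graph G
  open CubicWithFactor G simple cubic F one-factor

  depart arrive : Fin (suc k) → Dart G
  depart j = τ j , o j
  arrive j = τ j , not (o j)

  -- a tag (j , false) stands for depart j, (j , true) for arrive j
  Tag : Set
  Tag = Fin (suc k) × Bool

  dart : Tag → Dart G
  dart (j , false) = depart j
  dart (j , true) = arrive j

  vertex : Tag → Fin n
  vertex t = at G (dart t)

  dart-injective : ∀ t t' → dart t ≡ dart t' → t ≡ t'
  dart-injective (j , false) (j' , false) eq with τ-injective j j' (cong proj₁ eq)
  ... | refl = refl
  dart-injective (j , false) (j' , true) eq with τ-injective j j' (cong proj₁ eq)
  ... | refl = contradiction (cong proj₂ eq) (Bool.not-¬ refl)
  dart-injective (j , true) (j' , false) eq with τ-injective j j' (cong proj₁ eq)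
  ... | refl = contradiction (sym (cong proj₂ eq)) (Bool.not-¬ refl)
  dart-injective (j , true) (j' , true) eq with τ-injective j j' (cong proj₁ eq)
  ... | refl = refl

  dart-in-W : ∀ t → W (proj₁ (dart t)) ≡ true
  dart-in-W (j , false) = τ-in-W j
  dart-in-W (j , true) = τ-in-W j

  tag-in-Y : ∀ t → F (proj₁ (dart t)) ≡ false
  tag-in-Y t = W-subgraph _ (dart-in-W t)

  passage-darts-differ : ∀ j → arrive j ≢ depart (next j)
  passage-darts-differ j eq with dart-injective (j , true) (next j , false) eq
  ... | ()

  junction-edge : Fin (suc k) → Fin m
  junction-edge j = proj₁ (junction j)

  traversing-degree-2 : ∀ j → at G (arrive j) ≢ at G (depart (next j)) → DegW G F W (junction-edge j) 2
  traversing-degree-2 j trav with W-degrees (junction-edge j) (proj₁ (proj₁ (proj₂ (junction j))))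
  ... | inj₁ two = two
  ... | inj₂ four = contradiction (non-traversing j (junction-edge j) (proj₁ (proj₂ (junction j))) four) trav

  passage-darts : ∀ j t → vertex t ≡ at G (arrive j) ⊎ vertex t ≡ at G (depart (next j)) →
                  t ≡ (j , true) ⊎ t ≡ (next j , false)
  passage-darts j t t-at with at G (arrive j) Fin.≟ at G (depart (next j))
  ... | yes same with dart t ≟-dart arrive j | dart t ≟-dart depart (next j)
  ...   | yes eq | _ = inj₁ (dart-injective _ _ eq)
  ...   | no _ | yes eq = inj₂ (dart-injective _ _ eq)
  ...   | no ≢arrive | no ≢depart =
          contradiction t-at-arrive λ t-at → no-three-Y-darts (tag-in-Y (j , true)) (tag-in-Y (next j , false))
            (tag-in-Y t) refl (sym same) t-at (passage-darts-differ j) (≢-sym ≢arrive) (≢-sym ≢depart)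
    where
      t-at-arrive : vertex t ≡ at G (arrive j)
      t-at-arrive = [ (λ p → p) , (λ p → trans p (sym same)) ]′ t-at
  passage-darts j t t-at | no trav
    with card-2-exhausts _≟-dart_ (traversing-degree-2 j trav)
           (τ-in-W j , proj₁ (proj₂ (junction j))) (τ-in-W (next j) , proj₂ (proj₂ (junction j)))
           (passage-darts-differ j) (dart-in-W t , t-in-X)
    where
      t-in-X : InX G F (junction-edge j) (vertex t)
      t-in-X = [ (λ p → subst (InX G F (junction-edge j)) (sym p) (proj₁ (proj₂ (junction j)))) ,
                 (λ p → subst (InX G F (junction-edge j)) (sym p) (proj₂ (proj₂ (junction j)))) ]′ t-at
  ... | inj₁ eq = inj₁ (dart-injective _ _ eq)
  ... | inj₂ eq = inj₂ (dart-injective _ _ eq)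

  Kept : Tag → Set
  Kept (j , false) = ⊤
  Kept (j , true) = at G (arrive j) ≢ at G (depart (next j))

  Kept? : Decidable Kept
  Kept? (j , false) = yes tt
  Kept? (j , true) = ¬? (at G (arrive j) Fin.≟ at G (depart (next j)))

  kept-vertex-injective : ∀ t t' → Kept t → Kept t' → vertex t ≡ vertex t' → t ≡ t'
  kept-vertex-injective (j , true) t' trav _ eq with passage-darts j t' (inj₁ (sym eq))
  ... | inj₁ t'≡ = sym t'≡
  ... | inj₂ refl = contradiction eq trav
  kept-vertex-injective (j , false) t' _ kept' eq with predecessor j
  ... | i , refl with passage-darts i t' (inj₂ (sym eq))
  ...   | inj₁ refl = contradiction (sym eq) kept'
  ...   | inj₂ t'≡ = sym t'≡

  -- every vertex v carries a dart of W: otherwise all W-ends at the vertex x_e of the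
  -- F-edge e at v would sit at the other end of e, which neither degree 2 (admissibility)
  -- nor degree 4 (at most two Y-darts per vertex) allows
  W-dart-at : ∀ v → Σ (Dart G) λ d → W (proj₁ d) ≡ true × at G d ≡ v
  W-dart-at v with factor-dart v
  ... | (e , β) , Fe , refl with W-degrees e Fe
  ... | inj₁ two@(f , f-inj , f-end , _) with Fin.any? (λ i → at G (f i) Fin.≟ end e β)
  ...   | yes (i , at-v) = f i , proj₁ (f-end i) , at-v
  ...   | no none = contradiction (trans (far 0F) (sym (far 1F)))
                      (W-admissible e Fe two (f 0F) (f 1F) (f-end 0F) (f-end 1F) (λ eq → contradiction (f-inj 0F 1F eq) λ ()))
    where
      far : ∀ i → at G (f i) ≡ end e (not β)
      far i = other-end β (proj₂ (proj₂ (f-end i))) λ at-v → none (i , at-v)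
  W-dart-at v | (e , β) , Fe , refl | inj₂ (f , f-inj , f-end , _) with Fin.any? (λ i → at G (f i) Fin.≟ end e β)
  ...   | yes (i , at-v) = f i , proj₁ (f-end i) , at-v
  ...   | no none = ⊥-elim (no-three-Y-darts (Y 0F) (Y 1F) (Y 2F) (far 0F) (far 1F) (far 2F)
                      (λ eq → contradiction (f-inj 0F 1F eq) λ ()) (λ eq → contradiction (f-inj 0F 2F eq) λ ())
                      (λ eq → contradiction (f-inj 1F 2F eq) λ ()))
    where
      far : ∀ i → at G (f i) ≡ end e (not β)
      far i = other-end β (proj₂ (proj₂ (f-end i))) λ at-v → none (i , at-v)
      Y : ∀ i → F (proj₁ (f i)) ≡ false
      Y i = W-subgraph _ (proj₁ (f-end i))

  kept-tag-at : ∀ v → Σ Tag λ t → Kept t × vertex t ≡ v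
  kept-tag-at v with W-dart-at v
  ... | (x , γ) , w , at-v with τ-covers x w
  ... | j , refl with same-or-opposite γ (o j)
  ...   | inj₁ refl = (j , false) , tt , at-v
  ...   | inj₂ refl with Kept? (j , true)
  ...     | yes trav = (j , true) , trav , at-v
  ...     | no ¬trav = (next j , false) , tt ,
                       trans (sym (decidable-stable (at G (arrive j) Fin.≟ at G (depart (next j))) ¬trav)) at-v

  Step : Tag → Tag → Set
  Step (j , false) t = t ≡ (j , true)
  Step (j , true) t = t ≡ (next j , false)

  both-ends : List (Fin (suc k)) → List Tag
  both-ends [] = []
  both-ends (j ∷ js) = (j , false) ∷ (j , true) ∷ both-ends js

  both-ends-path : ∀ {x ys z} → Path (λ i j → next i ≡ j) x ys z → Path Step (x , true) (both-ends ys) (z , false)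
  both-ends-path (finish refl) = finish refl
  both-ends-path (refl ◅ p) = refl ◅ refl ◅ both-ends-path p

  both-ends-∈ : ∀ {j ys} β → j ∈ ys → (j , β) ∈ both-ends ys
  both-ends-∈ false (here refl) = here refl
  both-ends-∈ true (here refl) = there (here refl)
  both-ends-∈ β (there j∈) = there (there (both-ends-∈ β j∈))

  both-ends-fresh : ∀ {j ys} β → All (j ≢_) ys → All ((j , β) ≢_) (both-ends ys)
  both-ends-fresh β [] = []
  both-ends-fresh β (j≢ ∷ js) = (λ eq → j≢ (cong proj₁ eq)) ∷ (λ eq → j≢ (cong proj₁ eq)) ∷ both-ends-fresh β js

  both-ends-unique : ∀ {ys} → Unique ys → Unique (both-ends ys)
  both-ends-unique [] = []
  both-ends-unique (fresh ∷ u) = ((λ ()) ∷ both-ends-fresh false fresh) ∷ both-ends-fresh true fresh ∷ both-ends-unique u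

  all-tags : List Tag
  all-tags = both-ends (allFin (suc k))

  tag-walk : FilteredCycle Step Kept all-tags
  tag-walk = filter-cycle Kept? no-two-deleted (both-ends-unique (Unique.allFin⁺ (suc k)))
               (refl ◅ both-ends-path (cyclic-path (λ j → j) (λ _ → refl)))
    where
      no-two-deleted : ∀ {t t'} → Step t t' → ¬ Kept t → Kept t'
      no-two-deleted {j , false} _ ¬kept = contradiction tt ¬kept
      no-two-deleted {j , true} refl _ = tt

  -- consecutive kept tags lie at adjacent vertices: along a tour edge, across a traversed
  -- F-edge, or along a tour edge followed by a non-traversing passage
  step-adjacent : ∀ {t t'} → Kept t → Skip Step Kept t t' → Adjacent G (vertex t) (vertex t')
  step-adjacent {j , false} _ (inj₁ refl) = edge-adjacent (τ j) (o j)
  step-adjacent {j , true} trav (inj₁ refl) = contracted-adjacent (proj₁ (proj₂ (junction j))) (proj₂ (proj₂ (junction j))) trav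
  step-adjacent {j , false} _ (inj₂ (_ , refl , ¬trav , refl)) =
    subst (Adjacent G (vertex (j , false))) (decidable-stable (at G (arrive j) Fin.≟ at G (depart (next j))) ¬trav)
      (edge-adjacent (τ j) (o j))
  step-adjacent {j , true} _ (inj₂ (_ , refl , ¬kept , _)) = contradiction tt ¬kept

  open FilteredCycle tag-walk using (len; seq; kept; injective; complete; step)

  hamiltonian : Hamiltonian G
  hamiltonian = len , cycle , long , cycle-injective , cycle-onto , λ i → step-adjacent (kept i) (step i)
    where
      cycle : Fin (suc len) → Fin n
      cycle i = vertex (seq i)
      cycle-injective : ∀ i j → cycle i ≡ cycle j → i ≡ j
      cycle-injective i j eq = injective i j (kept-vertex-injective _ _ (kept i) (kept j) eq)
      cycle-onto : ∀ v → ∃ λ i → cycle i ≡ v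
      cycle-onto v with kept-tag-at v
      ... | t@(j , β) , kept-t , t-at with complete t (both-ends-∈ β (∈-allFin j)) kept-t
      ...   | i , refl = i , t-at
      -- the cycle lists every vertex once, and G has at least three vertices
      long : 3 ≤ suc len
      long with three-vertices nonempty
      ... | vs , u , three = subst (_≤ suc len) three
              (card-≤ (cycle , cycle-injective , (λ _ → tt) , λ v _ → cycle-onto v) u (universal (λ _ → tt) vs))

theorem4 : (G : Graph) → Simple G → Cubic G → Connected G →
           (F : Fin (Graph.m G) → Bool) → OneFactor G F →
           Hamiltonian G ⇔ (∃ λ W → GoodEulerianSubgraph G F W)
theorem4 G simple cubic (nonempty , _) F one-factor = mk⇔ to from
  where
    to : Hamiltonian G → ∃ λ W → GoodEulerianSubgraph G F W
    to (_ , c , long , c-injective , c-onto , c-adjacent) =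
      W , good-Eulerian-subgraph
      where open FromHamiltonianCycle G simple cubic F one-factor c long c-injective c-onto c-adjacent

    from : (∃ λ W → GoodEulerianSubgraph G F W) → Hamiltonian G
    from (W , W-subgraph , W-degrees , W-admissible ,
          (_ , τ , o , τ-in-W , τ-injective , τ-covers , junction , non-traversing)) =
      hamiltonian
      where open FromGoodEulerianSubgraph G simple cubic F one-factor nonempty W W-subgraph W-degrees
                   W-admissible τ o τ-in-W τ-injective τ-covers junction non-traversing
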